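{- Let $p$ be a prime number such that $g=p+1$ is an even integer with $g\ge4$. Then there is no primitive number $m\neq g-1$ with $o_g(m)<g$, and for every prime number $q>g$ there exists a primitive number $m$ with $o_g(m)=q$.
   Context: For an odd integer $m\ge1$, an extreme cycle for the digit set $\{0,m\}$ (with respect to $g$) is a finite set of distinct integers $\{x_0,\dots,x_{r-1}\}$ together with digits $l_0,\dots,l_{r-1}\in\{0,m\}$ such that $x_{j+1}=(x_j+l_j)/g$ for $0\le j\le r-2$ and $x_0=(x_{r-1}+l_{r-1})/g$. The cycle $\{0\}$ is the trivial extreme cycle. $m$ is complete if the only extreme cycle for $\{0,m\}$ is the trivial one, and incomplete otherwise. An odd number $m$ is primitive if it is incomplete and every proper divisor of $m$ is complete; primitive numbers are coprime to $g$, and $o_g(m)$ denotes the order of $g$ in $U(\mathbb{Z}_m)$. -}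

module Defs where

open import Data.Nat as ℕ using (ℕ; zero; suc; _∸_; _^_; _<_; _≤_)
open import Data.Nat.Divisibility using (_∣_)
open import Data.Integer as ℤ using (ℤ; +_)
open import Data.Fin using (Fin; zero; suc; inject₁; fromℕ)
open import Data.Product using (Σ; _×_)
open import Data.Sum using (_⊎_)
open import Relation.Binary.PropositionalEquality using (_≡_)
open import Relation.Nullary using (¬_)
open import Function.Definitions using (Injective)

Odd : ℕ → Set
Odd m = ¬ (2 ∣ m)

-- An extreme cycle for the digit set {0,m} with respect to base g, of length
-- r = suc n: distinct integers x_0,…,x_n (x injective) and digits l_j ∈ {0,m}
-- with x_{j+1} = (x_j + l_j)/g (exact division, i.e. g·x_{j+1} = x_j + l_j)
-- and x_0 = (x_n + l_n)/g.
record ExtremeCycle (g m : ℕ) : Set where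
  field
    n     : ℕ
    x     : Fin (suc n) → ℤ
    l     : Fin (suc n) → ℤ
    x-inj : Injective _≡_ _≡_ x
    l-dig : ∀ j → l j ≡ + 0 ⊎ l j ≡ + m
    step  : ∀ (j : Fin n) → (+ g) ℤ.* x (suc j) ≡ x (inject₁ j) ℤ.+ l (inject₁ j)
    close : (+ g) ℤ.* x zero ≡ x (fromℕ n) ℤ.+ l (fromℕ n)

Trivial : ∀ {g m} → ExtremeCycle g m → Set
Trivial C = ExtremeCycle.n C ≡ 0 × ExtremeCycle.x C zero ≡ + 0

Complete : ℕ → ℕ → Set
Complete g m = Odd m × (∀ (C : ExtremeCycle g m) → Trivial C)

Incomplete : ℕ → ℕ → Set
Incomplete g m = Odd m × Σ (ExtremeCycle g m) (λ C → ¬ Trivial C)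

Primitive : ℕ → ℕ → Set
Primitive g m = Incomplete g m × (∀ d → d ∣ m → ¬ d ≡ m → Complete g d)

IsOrder : ℕ → ℕ → ℕ → Set
IsOrder g m k = 1 ≤ k × m ∣ (g ^ k ∸ 1) × (∀ j → 1 ≤ j → j < k → ¬ (m ∣ (g ^ j ∸ 1)))

-- Read a non-trivial extreme cycle for {0, m} round and round as a periodic
-- sequence of naturals with g · Y (i + 1) ≡ Y i + m · bᵢ, bᵢ ∈ {0, 1}.  Then
-- 0 < Y i < m, and m ∣ g ^ k ∸ 1 forces Y k ≡ Y 0, so the cycle length r
-- divides o_g(m).  Unrolling one period gives p · R · Y 0 ≡ m · V, where
-- R = (g ^ r ∸ 1) / p and V is the base-g value of the digits bᵢ.
--
-- If o_g(m) < g, reduce modulo p (g ≡ 1): p divides m times the number of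
-- digits 1, which is at most r ≤ p, so p ∣ m.  As p is itself incomplete (the
-- cycle {1}), primitivity leaves only m = p.
--
-- For a prime q > g put M = (g ^ q ∸ 1) / p.  A divisor d of M is incomplete
-- exactly when some non-zero q-periodic 0/1 word has value divisible by p · M / d:
-- dividing the rotations of such a word by p · M / d gives a cycle, and the
-- digits of a cycle give such a word.  The least such d is primitive; its cycles
-- have length dividing q and not 1 (as p ∤ M), so o_g(d) = q.

module Submission where

open import Defs
open import Data.Bool using (Bool; true; false)
open import Data.Empty using (⊥; ⊥-elim)
open import Function using (_∘_; id)
open import Data.Nat
open import Data.Nat.Properties
open import Data.Integer as ℤ using (ℤ; +_; -[1+_])
import Data.Integer.Properties as ℤ
open import Data.Fin using (Fin; zero; suc; toℕ; fromℕ; inject₁)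
open import Data.Fin.Relation.Unary.Top using (View; view; ‵fromℕ; ‵inject₁)
open import Data.Fin.Properties using (toℕ-fromℕ; toℕ-fromℕ<; toℕ-inject₁; toℕ-injective; toℕ<n)
open import Data.Nat.DivMod
open import Data.Nat.Coprimality using (Coprime; coprime-divisor)
open import Data.Nat.Divisibility
open import Data.Nat.Induction using (<-rec)
open import Data.Nat.Primality using (Prime; prime⇒nonZero; prime⇒nonTrivial; prime⇒irreducible; euclidsLemma)
open import Data.Nat.Tactic.RingSolver using (solve-∀)
open import Data.Product using (Σ; ∃; ∃-syntax; _×_; _,_; proj₁; proj₂)
open import Data.Sum using (_⊎_; inj₁; inj₂; [_,_]′)
open import Data.Vec using (Vec; []; _∷_; lookup; tabulate)
open import Data.Vec.Properties using (lookup∘tabulate)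
open import Relation.Binary.PropositionalEquality
open import Relation.Nullary using (¬_; ¬?; Dec; yes; no; does)
open import Relation.Nullary.Decidable using (map′; _⊎-dec_; _×-dec_; dec-true; dec-false; decidable-stable)
open import Relation.Unary using (Decidable)
open import Relation.Binary.Definitions using (tri<; tri≈; tri>)

bit : Bool → ℕ
bit false = 0
bit true  = 1

bit≤1 : ∀ b → bit b ≤ 1
bit≤1 false = z≤n
bit≤1 true  = s≤s z≤n

numeral : ℕ → (ℕ → ℕ) → ℕ → ℕ → ℕ
numeral G c j zero      = 0
numeral G c j (suc len) = c j + G * numeral G c (suc j) len

repunit : ℕ → ℕ → ℕ
repunit G zero    = 0
repunit G (suc n) = 1 + G * repunit G n

numeral-cong : ∀ G {c c′} j len → (∀ i → i < j + len → c i ≡ c′ i) →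
               numeral G c j len ≡ numeral G c′ j len
numeral-cong G j zero      eq = refl
numeral-cong G j (suc len) eq =
  cong₂ (λ a b → a + G * b) (eq j (m<m+n j z<s))
        (numeral-cong G (suc j) len (λ i i< → eq i (subst (i <_) (sym (+-suc j len)) i<)))

numeral-periodic : ∀ G {c} q → (∀ i → c (i + q) ≡ c i) →
                   ∀ j len → numeral G c (j + q) len ≡ numeral G c j len
numeral-periodic G q per j zero      = refl
numeral-periodic G q per j (suc len) =
  cong₂ (λ a b → a + G * b) (per j) (numeral-periodic G q per (suc j) len)

numeral-snoc : ∀ G c j len →
               numeral G c j (suc len) ≡ numeral G c j len + G ^ len * c (j + len)
numeral-snoc G c j zero rewrite +-identityʳ j = cong (λ x → c j + x) (*-zeroʳ G)
numeral-snoc G c j (suc len) = begin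
  c j + G * numeral G c (suc j) (suc len)
    ≡⟨ cong (λ v → c j + G * v) (numeral-snoc G c (suc j) len) ⟩
  c j + G * (numeral G c (suc j) len + G ^ len * c (suc j + len))
    ≡⟨ cong (λ i → c j + G * (numeral G c (suc j) len + G ^ len * c i)) (sym (+-suc j len)) ⟩
  c j + G * (numeral G c (suc j) len + G ^ len * c (j + suc len))
    ≡⟨ distrib (c j) G (numeral G c (suc j) len) (G ^ len) (c (j + suc len)) ⟩
  c j + G * numeral G c (suc j) len + G * G ^ len * c (j + suc len) ∎
  where
  open ≡-Reasoning
  distrib : ∀ a G v P b → a + G * (v + P * b) ≡ a + G * v + G * P * b
  distrib = solve-∀

repunit-power : ∀ p n → p * repunit (suc p) n + 1 ≡ suc p ^ n
repunit-power p zero    = cong (_+ 1) (*-zeroʳ p)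
repunit-power p (suc n) = begin
  p * (1 + suc p * repunit (suc p) n) + 1 ≡⟨ factor p (repunit (suc p) n) ⟩
  suc p * (p * repunit (suc p) n + 1)     ≡⟨ cong (suc p *_) (repunit-power p n) ⟩
  suc p * suc p ^ n                       ∎
  where
  open ≡-Reasoning
  factor : ∀ p R → p * (1 + suc p * R) + 1 ≡ suc p * (p * R + 1)
  factor = solve-∀

repunit-mod : ∀ p n → ∃[ W ] repunit (suc p) n ≡ n + p * W
repunit-mod p zero    = 0 , sym (*-zeroʳ p)
repunit-mod p (suc n) with repunit-mod p n
... | W , eq = W + (n + p * W) , trans (cong (λ R → 1 + suc p * R) eq) (expand p n W)
  where
  expand : ∀ p n W → 1 + suc p * (n + p * W) ≡ suc n + p * (W + (n + p * W))
  expand = solve-∀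

-- Since suc p ≡ 1 modulo p, a numeral is congruent to its digit sum.
numeral-mod : ∀ p c j len → ∃[ W ] numeral (suc p) c j len ≡ numeral 1 c j len + p * W
numeral-mod p c j zero      = 0 , sym (*-zeroʳ p)
numeral-mod p c j (suc len) with numeral-mod p c (suc j) len
... | W , eq = W + (numeral 1 c (suc j) len + p * W) ,
  trans (cong (λ N → c j + suc p * N) eq) (expand p (c j) (numeral 1 c (suc j) len) W)
  where
  expand : ∀ p a T W → a + suc p * (T + p * W) ≡ a + 1 * T + p * (W + (T + p * W))
  expand = solve-∀

numeral-zeros : ∀ G c j len → (∀ i → j ≤ i → c i ≡ 0) → numeral G c j len ≡ 0
numeral-zeros G c j zero      _     = refl
numeral-zeros G c j (suc len) zeros =
  trans (cong₂ (λ a b → a + G * b) (zeros j ≤-refl)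
               (numeral-zeros G c (suc j) len (λ i j<i → zeros i (<⇒≤ j<i))))
        (*-zeroʳ G)

numeral₁≡0⇒≡0 : ∀ G c j len → numeral 1 c j len ≡ 0 → numeral G c j len ≡ 0
numeral₁≡0⇒≡0 G c j zero      _   = refl
numeral₁≡0⇒≡0 G c j (suc len) eq0 = begin
  c j + G * numeral G c (suc j) len ≡⟨ cong₂ (λ a N → a + G * N) (m+n≡0⇒m≡0 (c j) eq0) rest≡0 ⟩
  G * 0                             ≡⟨ *-zeroʳ G ⟩
  0                                 ∎
  where
  open ≡-Reasoning
  rest≡0 : numeral G c (suc j) len ≡ 0
  rest≡0 = numeral₁≡0⇒≡0 G c (suc j) len
             (trans (sym (*-identityˡ _)) (m+n≡0⇒n≡0 (c j) eq0))

numeral₁-bits≤ : ∀ B j len → numeral 1 (bit ∘ B) j len ≤ len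
numeral₁-bits≤ B j zero      = z≤n
numeral₁-bits≤ B j (suc len) =
  +-mono-≤ (bit≤1 (B j)) (≤-trans (≤-reflexive (*-identityˡ _)) (numeral₁-bits≤ B (suc j) len))

numeral₁-bits≡len : ∀ G B j len → numeral 1 (bit ∘ B) j len ≡ len →
                    numeral G (bit ∘ B) j len ≡ repunit G len
numeral₁-bits≡len G B j zero      _ = refl
numeral₁-bits≡len G B j (suc len) eq with B j
... | false = ⊥-elim (<-irrefl eq
  (s≤s (≤-trans (≤-reflexive (*-identityˡ _)) (numeral₁-bits≤ B (suc j) len))))
... | true  = cong (λ N → 1 + G * N)
  (numeral₁-bits≡len G B (suc j) len (trans (sym (*-identityˡ _)) (suc-injective eq)))

numeral-prefix : ∀ G b j P e → j + P ≡ b →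
                 numeral G (λ i → bit (does (i <? b))) j (P + e) ≡ repunit G P
numeral-prefix G b j zero    e j≡b = numeral-zeros G _ j e
  (λ i j≤i → cong bit (dec-false (i <? b)
    (≤⇒≯ (subst (_≤ i) (trans (sym (+-identityʳ j)) j≡b) j≤i))))
numeral-prefix G b j (suc P) e j+P≡b = cong₂ (λ a N → a + G * N)
  (cong bit (dec-true (j <? b) (subst (j <_) j+P≡b (m<m+n j z<s))))
  (numeral-prefix G b (suc j) P e (trans (sym (+-suc j P)) j+P≡b))

minimal : ∀ {P : ℕ → Set} → Decidable P → ∀ {n} → P n →
          ∃[ m ] P m × (∀ {k} → k < m → ¬ P k)
minimal {P} P? {n} = <-rec (λ n → P n → ∃[ m ] P m × (∀ {k} → k < m → ¬ P k)) search n
  where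
  search : ∀ n → (∀ {k} → k < n → P k → ∃[ m ] P m × (∀ {k} → k < m → ¬ P k)) →
           P n → ∃[ m ] P m × (∀ {k} → k < m → ¬ P k)
  search n below Pn with anyUpTo? P? n
  ... | yes (k , k<n , Pk) = below k<n Pk
  ... | no none            = n , Pn , λ k<n Pk → none (_ , k<n , Pk)

any-Vec-Bool? : ∀ {n} {P : Vec Bool n → Set} → Decidable P → Dec (∃ P)
any-Vec-Bool? {zero}  P? = map′ ([] ,_) (λ { ([] , p) → p }) (P? [])
any-Vec-Bool? {suc n} P? =
  map′ (λ { (inj₁ (w , p)) → true ∷ w , p ; (inj₂ (w , p)) → false ∷ w , p })
       (λ { (true ∷ w , p) → inj₁ (w , p) ; (false ∷ w , p) → inj₂ (w , p) })
       (any-Vec-Bool? (P? ∘ (true ∷_)) ⊎-dec any-Vec-Bool? (P? ∘ (false ∷_)))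

2≤^suc : ∀ {G} r → 2 ≤ G → 2 ≤ G ^ suc r
2≤^suc {G@(suc _)} r 2≤G = ≤-trans 2≤G (m≤m*n G (G ^ r) {{m^n≢0 G r}})

contraction-iterate : ∀ G (v : ℕ → ℕ) → (∀ i → G * v (suc i) ≤ v i) →
                      ∀ i j → G ^ j * v (i + j) ≤ v i
contraction-iterate G v shrink i zero    rewrite +-identityʳ i = ≤-reflexive (*-identityˡ (v i))
contraction-iterate G v shrink i (suc j) = begin
  G * G ^ j * v (i + suc j)   ≡⟨ cong (λ k → G * G ^ j * v k) (+-suc i j) ⟩
  G * G ^ j * v (suc (i + j)) ≡⟨ cong (_* v (suc (i + j))) (*-comm G (G ^ j)) ⟩
  G ^ j * G * v (suc (i + j)) ≡⟨ *-assoc (G ^ j) G _ ⟩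
  G ^ j * (G * v (suc (i + j))) ≤⟨ *-monoʳ-≤ (G ^ j) (shrink (i + j)) ⟩
  G ^ j * v (i + j)           ≤⟨ contraction-iterate G v shrink i j ⟩
  v i                         ∎
  where open ≤-Reasoning

periodic-contraction≡0 : ∀ {G} (v : ℕ → ℕ) r → 2 ≤ G → (∀ i → G * v (suc i) ≤ v i) →
                         (∀ i → v (i + suc r) ≡ v i) → ∀ i → v i ≡ 0
periodic-contraction≡0 {G} v r 2≤G shrink per i = scaled≤⇒≡0 (2≤^suc r 2≤G)
  (subst (λ y → G ^ suc r * y ≤ v i) (per i) (contraction-iterate G v shrink i (suc r)))
  where
  scaled≤⇒≡0 : ∀ {a x} → 2 ≤ a → a * x ≤ x → x ≡ 0
  scaled≤⇒≡0 {a} {x} 2≤a ax≤x = trans (sym (+-identityʳ x)) (n≤0⇒n≡0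
    (+-cancelˡ-≤ x (x + 0) 0
      (≤-trans (*-monoˡ-≤ x 2≤a) (≤-trans ax≤x (≤-reflexive (sym (+-identityʳ x)))))))

expansion-iterate : ∀ G (a : ℕ → ℤ) → (∀ i → a i ℤ.≤ + G ℤ.* a (suc i)) →
                    ∀ i j → a i ℤ.≤ + (G ^ j) ℤ.* a (i + j)
expansion-iterate G a grow i zero    rewrite +-identityʳ i = ℤ.≤-reflexive (sym (ℤ.*-identityˡ (a i)))
expansion-iterate G a grow i (suc j) = begin
  a i                                     ≤⟨ expansion-iterate G a grow i j ⟩
  + (G ^ j) ℤ.* a (i + j)                 ≤⟨ ℤ.*-monoˡ-≤-nonNeg (+ (G ^ j)) (grow (i + j)) ⟩
  + (G ^ j) ℤ.* (+ G ℤ.* a (suc (i + j))) ≡⟨ ℤ.*-assoc (+ (G ^ j)) (+ G) _ ⟨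
  + (G ^ j) ℤ.* + G ℤ.* a (suc (i + j))   ≡⟨ cong₂ ℤ._*_ G^j*G≡G^suc-j (cong a (sym (+-suc i j))) ⟩
  + (G * G ^ j) ℤ.* a (i + suc j)         ∎
  where
  open ℤ.≤-Reasoning
  G^j*G≡G^suc-j : + (G ^ j) ℤ.* + G ≡ + (G * G ^ j)
  G^j*G≡G^suc-j = trans (sym (ℤ.pos-* (G ^ j) G)) (cong +_ (*-comm (G ^ j) G))

periodic-expansion-nonNeg : ∀ {G} (a : ℕ → ℤ) r → 2 ≤ G → (∀ i → a i ℤ.≤ + G ℤ.* a (suc i)) →
                            (∀ i → a (i + suc r) ≡ a i) → ∀ i → + 0 ℤ.≤ a i
periodic-expansion-nonNeg {G} a r 2≤G grow per i = nonNeg (a i) (2≤^suc r 2≤G)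
  (subst (λ y → a i ℤ.≤ + (G ^ suc r) ℤ.* y) (per i) (expansion-iterate G a grow i (suc r)))
  where
  nonNeg : ∀ x {M} → 2 ≤ M → x ℤ.≤ + M ℤ.* x → + 0 ℤ.≤ x
  nonNeg (+ n)                  _         _  = ℤ.+≤+ z≤n
  nonNeg -[1+ k ] {suc zero}    (s≤s ()) _
  nonNeg -[1+ k ] {suc (suc m)} _         le = ⊥-elim (m+1+n≰m k (ℤ.drop‿-≤- le))

toℕ-mod : ∀ i n → toℕ (i mod suc n) ≡ i % suc n
toℕ-mod i n = toℕ-fromℕ< _

mod-periodic : ∀ i n → (i + suc n) mod suc n ≡ i mod suc n
mod-periodic i n = toℕ-injective (begin
  toℕ ((i + suc n) mod suc n) ≡⟨ toℕ-mod (i + suc n) n ⟩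
  (i + suc n) % suc n         ≡⟨ [m+n]%n≡m%n i (suc n) ⟩
  i % suc n                   ≡⟨ toℕ-mod i n ⟨
  toℕ (i mod suc n)           ∎)
  where open ≡-Reasoning

mod≡zero⇒∣ : ∀ i n → i mod suc n ≡ zero → suc n ∣ i
mod≡zero⇒∣ i n eq = m%n≡0⇒n∣m i (suc n) (trans (sym (toℕ-mod i n)) (cong toℕ eq))

suc-%≡ : ∀ i n {k} → i mod suc n ≡ k → suc i % suc n ≡ suc (toℕ k) % suc n
suc-%≡ i n {k} eq = begin
  suc i % suc n
    ≡⟨ cong (λ y → suc y % suc n) (m≡m%n+[m/n]*n i (suc n)) ⟩
  (suc (i % suc n) + i / suc n * suc n) % suc n
    ≡⟨ [m+kn]%n≡m%n (suc (i % suc n)) (i / suc n) (suc n) ⟩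
  suc (i % suc n) % suc n
    ≡⟨ cong (λ y → suc y % suc n) (trans (sym (toℕ-mod i n)) (cong toℕ eq)) ⟩
  suc (toℕ k) % suc n ∎
  where open ≡-Reasoning

mod-suc-fromℕ : ∀ i n → i mod suc n ≡ fromℕ n → suc i mod suc n ≡ zero
mod-suc-fromℕ i n eq = toℕ-injective (begin
  toℕ (suc i mod suc n)   ≡⟨ toℕ-mod (suc i) n ⟩
  suc i % suc n           ≡⟨ suc-%≡ i n eq ⟩
  suc (toℕ (fromℕ n)) % suc n ≡⟨ cong (λ y → suc y % suc n) (toℕ-fromℕ n) ⟩
  suc n % suc n           ≡⟨ n%n≡0 (suc n) ⟩
  0                       ∎)
  where open ≡-Reasoning

mod-suc-inject₁ : ∀ i {n} (j : Fin n) → i mod suc n ≡ inject₁ j → suc i mod suc n ≡ suc j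
mod-suc-inject₁ i {n} j eq = toℕ-injective (begin
  toℕ (suc i mod suc n)         ≡⟨ toℕ-mod (suc i) n ⟩
  suc i % suc n                 ≡⟨ suc-%≡ i n eq ⟩
  suc (toℕ (inject₁ j)) % suc n ≡⟨ cong (λ y → suc y % suc n) (toℕ-inject₁ j) ⟩
  suc (toℕ j) % suc n           ≡⟨ m<n⇒m%n≡m (s≤s (toℕ<n j)) ⟩
  suc (toℕ j)                   ∎)
  where open ≡-Reasoning

Odd⇒NonZero : ∀ {m} → Odd m → NonZero m
Odd⇒NonZero {zero}  odd = ⊥-elim (odd (divides 0 refl))
Odd⇒NonZero {suc m} _   = _

bit-of : ∀ {l d} → l ≡ + 0 ⊎ l ≡ + d → ∃[ b ] l ≡ + (d * bit b)
bit-of {d = d} (inj₁ l≡0) = false , trans l≡0 (cong +_ (sym (*-zeroʳ d)))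
bit-of {d = d} (inj₂ l≡d) = true  , trans l≡d (cong +_ (sym (*-identityʳ d)))

module CycleOrbit {p d : ℕ} .{{_ : NonZero d}} (2≤p : 2 ≤ p) (C : ExtremeCycle (suc p) d) where
  open ExtremeCycle C

  g r : ℕ
  g = suc p
  r = suc n

  2≤g : 2 ≤ g
  2≤g = ≤-trans 2≤p (n≤1+n p)

  X : ℕ → ℤ
  X i = x (i mod r)

  digit : ℕ → Bool
  digit i = proj₁ (bit-of (l-dig (i mod r)))

  X-step : ∀ i → + g ℤ.* X (suc i) ≡ X i ℤ.+ + (d * bit (digit i))
  X-step i = trans (at (view (i mod r)) refl)
                   (cong (λ k → X i ℤ.+ k) (proj₂ (bit-of (l-dig (i mod r)))))
    where
    at : ∀ {j} → View j → i mod r ≡ j → + g ℤ.* x (suc i mod r) ≡ x j ℤ.+ l j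
    at ‵fromℕ       eq = subst (λ k → + g ℤ.* x k ≡ _) (sym (mod-suc-fromℕ i n eq)) close
    at (‵inject₁ j) eq = subst (λ k → + g ℤ.* x k ≡ _) (sym (mod-suc-inject₁ i j eq)) (step j)

  X-nonNeg : ∀ i → + 0 ℤ.≤ X i
  X-nonNeg = periodic-expansion-nonNeg X n 2≤g grow (λ i → cong x (mod-periodic i n))
    where
    grow : ∀ i → X i ℤ.≤ + g ℤ.* X (suc i)
    grow i = subst (X i ℤ.≤_) (sym (X-step i)) (ℤ.i≤i+j (X i) _)

  Y : ℕ → ℕ
  Y i = ℤ.∣ X i ∣

  X≡+Y : ∀ i → X i ≡ + Y i
  X≡+Y i = sym (ℤ.0≤i⇒+∣i∣≡i (X-nonNeg i))

  Y-step : ∀ i → g * Y (suc i) ≡ Y i + d * bit (digit i)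
  Y-step i = ℤ.+-injective (begin
    + (g * Y (suc i))               ≡⟨ ℤ.pos-* g (Y (suc i)) ⟩
    + g ℤ.* + Y (suc i)             ≡⟨ cong (+ g ℤ.*_) (X≡+Y (suc i)) ⟨
    + g ℤ.* X (suc i)               ≡⟨ X-step i ⟩
    X i ℤ.+ + (d * bit (digit i))   ≡⟨ cong (ℤ._+ + (d * bit (digit i))) (X≡+Y i) ⟩
    + Y i ℤ.+ + (d * bit (digit i)) ≡⟨ ℤ.pos-+ (Y i) _ ⟨
    + (Y i + d * bit (digit i))     ∎)
    where open ≡-Reasoning

  Y-periodic : ∀ i → Y (i + r) ≡ Y i
  Y-periodic i = cong (λ j → ℤ.∣ x j ∣) (mod-periodic i n)

  Y-return : ∀ i → Y i ≡ Y 0 → r ∣ i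
  Y-return i eq = mod≡zero⇒∣ i n (x-inj (trans (X≡+Y i) (trans (cong +_ eq) (sym (X≡+Y 0)))))

  -- The excess p · Y i ∸ d over the fixed point d / p of the digit-d map
  -- shrinks by a factor g, so it vanishes along a periodic orbit.
  p*Y≤d : ∀ i → p * Y i ≤ d
  p*Y≤d i = m∸n≡0⇒m≤n (periodic-contraction≡0 (λ i → p * Y i ∸ d) n 2≤g shrink
                         (λ i → cong (λ y → p * y ∸ d) (Y-periodic i)) i)
    where
    shrink : ∀ i → g * (p * Y (suc i) ∸ d) ≤ p * Y i ∸ d
    shrink i = begin
      g * (p * Y (suc i) ∸ d)               ≡⟨ *-distribˡ-∸ g (p * Y (suc i)) d ⟩
      g * (p * Y (suc i)) ∸ g * d           ≡⟨ cong (_∸ g * d) (swap g p (Y (suc i))) ⟩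
      p * (g * Y (suc i)) ∸ g * d           ≡⟨ cong (λ y → p * y ∸ g * d) (Y-step i) ⟩
      p * (Y i + d * bit (digit i)) ∸ g * d
        ≤⟨ ∸-monoˡ-≤ (g * d) (*-monoʳ-≤ p (+-monoʳ-≤ (Y i) d*b≤d)) ⟩
      p * (Y i + d) ∸ g * d                 ≡⟨ cong₂ _∸_ (expand p (Y i) d) (+-comm d (p * d)) ⟩
      (p * d + p * Y i) ∸ (p * d + d)       ≡⟨ [m+n]∸[m+o]≡n∸o (p * d) (p * Y i) d ⟩
      p * Y i ∸ d                           ∎
      where
      open ≤-Reasoning
      swap : ∀ g p y → g * (p * y) ≡ p * (g * y)
      swap = solve-∀
      expand : ∀ p y d → p * (y + d) ≡ p * d + p * y
      expand = solve-∀
      d*b≤d : d * bit (digit i) ≤ d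
      d*b≤d = ≤-trans (*-monoʳ-≤ d (bit≤1 (digit i))) (≤-reflexive (*-identityʳ d))

  Y<d : ∀ i → Y i < d
  Y<d i = *-cancelˡ-< p (Y i) d (≤-<-trans (p*Y≤d i)
            (subst (d <_) (*-comm d p) (m<m*n d p 2≤p)))

  Y-unroll : ∀ j len → g ^ len * Y (j + len) ≡ Y j + d * numeral g (bit ∘ digit) j len
  Y-unroll j zero = begin
    1 * Y (j + 0) ≡⟨ *-identityˡ _ ⟩
    Y (j + 0)     ≡⟨ cong Y (+-identityʳ j) ⟩
    Y j           ≡⟨ +-identityʳ (Y j) ⟨
    Y j + 0       ≡⟨ cong (λ z → Y j + z) (*-zeroʳ d) ⟨
    Y j + d * 0   ∎
    where open ≡-Reasoning
  Y-unroll j (suc len) = begin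
    g * g ^ len * Y (j + suc len)                ≡⟨ cong (λ k → g * g ^ len * Y k) (+-suc j len) ⟩
    g * g ^ len * Y (suc j + len)                ≡⟨ *-assoc g (g ^ len) _ ⟩
    g * (g ^ len * Y (suc j + len))              ≡⟨ cong (g *_) (Y-unroll (suc j) len) ⟩
    g * (Y (suc j) + d * N)                      ≡⟨ expand g (Y (suc j)) d N ⟩
    g * Y (suc j) + d * (g * N)                  ≡⟨ cong (_+ d * (g * N)) (Y-step j) ⟩
    Y j + d * bit (digit j) + d * (g * N)        ≡⟨ collect (Y j) d (bit (digit j)) (g * N) ⟩
    Y j + d * (bit (digit j) + g * N)            ∎
    where
    open ≡-Reasoning
    N = numeral g (bit ∘ digit) (suc j) len
    expand : ∀ g y d N → g * (y + d * N) ≡ g * y + d * (g * N)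
    expand = solve-∀
    collect : ∀ y d b M → y + d * b + d * M ≡ y + d * (b + M)
    collect = solve-∀

  Y-order : ∀ k → d ∣ g ^ k ∸ 1 → Y k ≡ Y 0
  Y-order k (divides c g^k∸1≡c*d) = begin
    Y k                     ≡⟨ m<n⇒m%n≡m (Y<d k) ⟨
    Y k % d                 ≡⟨ [m+kn]%n≡m%n (Y k) (c * Y k) d ⟨
    (Y k + c * Y k * d) % d ≡⟨ cong (_% d) (trans (regroup c d (Y k)) (cong (_* Y k) g^k≡c*d+1)) ⟩
    (g ^ k * Y k) % d       ≡⟨ cong (_% d) (trans (Y-unroll 0 k) (cong (λ z → Y 0 + z) (*-comm d V))) ⟩
    (Y 0 + V * d) % d       ≡⟨ [m+kn]%n≡m%n (Y 0) V d ⟩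
    Y 0 % d                 ≡⟨ m<n⇒m%n≡m (Y<d 0) ⟩
    Y 0                     ∎
    where
    open ≡-Reasoning
    V = numeral g (bit ∘ digit) 0 k
    g^k≡c*d+1 : c * d + 1 ≡ g ^ k
    g^k≡c*d+1 = trans (cong (_+ 1) (sym g^k∸1≡c*d)) (m∸n+n≡m (m^n>0 g k))
    regroup : ∀ c d y → y + c * y * d ≡ (c * d + 1) * y
    regroup = solve-∀

  Y-return-identity : ∀ k → Y k ≡ Y 0 → p * repunit g k * Y 0 ≡ d * numeral g (bit ∘ digit) 0 k
  Y-return-identity k Yk≡Y0 = +-cancelˡ-≡ (Y 0) _ _ (begin
    Y 0 + p * repunit g k * Y 0 ≡⟨ regroup (Y 0) p (repunit g k) ⟩
    (p * repunit g k + 1) * Y 0 ≡⟨ cong (_* Y 0) (repunit-power p k) ⟩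
    g ^ k * Y 0                 ≡⟨ cong (g ^ k *_) Yk≡Y0 ⟨
    g ^ k * Y k                 ≡⟨ Y-unroll 0 k ⟩
    Y 0 + d * numeral g (bit ∘ digit) 0 k ∎)
    where
    open ≡-Reasoning
    regroup : ∀ y p R → y + p * R * y ≡ (p * R + 1) * y
    regroup = solve-∀

  Y₀≢0 : 2 ∣ g → Odd d → ¬ Trivial C → Y 0 ≢ 0
  Y₀≢0 2∣g odd nontrivial Y₀≡0 = nontrivial (n≡0 , trans (X≡+Y 0) (cong +_ Y₀≡0))
    where
    Y₁≡0 : Y 1 ≡ 0
    Y₁≡0 with digit 0 | trans (Y-step 0) (cong (_+ d * bit (digit 0)) Y₀≡0)
    ... | false | gY₁≡d*0 =
      *-cancelˡ-≡ (Y 1) 0 g (trans gY₁≡d*0 (trans (*-zeroʳ d) (sym (*-zeroʳ g))))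
    ... | true  | gY₁≡d*1 =
      ⊥-elim (odd (subst (2 ∣_) (trans gY₁≡d*1 (*-identityʳ d)) (∣m⇒∣m*n (Y 1) 2∣g)))
    n≡0 : n ≡ 0
    n≡0 = suc-injective (∣1⇒≡1 (Y-return 1 (trans Y₁≡0 (sym Y₀≡0))))

-- A periodic solution of g · Y (i + 1) ≡ Y i + d · digit i with Y 0 ≢ 0,
-- cut off at its first return to Y 0, is a non-trivial cycle for {0, d}.
module OrbitCycle {p d : ℕ} (2∣g : 2 ∣ suc p) (odd : Odd d) (q′ : ℕ)
                  (Y : ℕ → ℕ) (digit : ℕ → Bool)
                  (Y-step : ∀ i → suc p * Y (suc i) ≡ Y i + d * bit (digit i))
                  (Y-periodic : ∀ i → Y (i + suc q′) ≡ Y i) (Y₀≢0 : Y 0 ≢ 0) where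
  g : ℕ
  g = suc p

  -- g is even and d odd, so the parity of y fixes the digit.
  digits-differ-in-parity : ∀ {y y₁ y₂} → g * y₁ ≡ y + d * 0 → g * y₂ ≡ y + d * 1 → ⊥
  digits-differ-in-parity {y} {y₁} {y₂} e₁ e₂ = odd (∣m+n∣m⇒∣n
    (subst (2 ∣_) (trans e₂ (cong (λ z → y + z) (*-identityʳ d))) (∣m⇒∣m*n y₂ 2∣g))
    (subst (2 ∣_) (trans e₁ (trans (cong (λ z → y + z) (*-zeroʳ d)) (+-identityʳ y)))
                  (∣m⇒∣m*n y₁ 2∣g)))

  step-injective : ∀ {y y₁ y₂} b₁ b₂ →
                   g * y₁ ≡ y + d * bit b₁ → g * y₂ ≡ y + d * bit b₂ → y₁ ≡ y₂
  step-injective false false e₁ e₂ = *-cancelˡ-≡ _ _ g (trans e₁ (sym e₂))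
  step-injective true  true  e₁ e₂ = *-cancelˡ-≡ _ _ g (trans e₁ (sym e₂))
  step-injective false true  e₁ e₂ = ⊥-elim (digits-differ-in-parity e₁ e₂)
  step-injective true  false e₁ e₂ = ⊥-elim (digits-differ-in-parity e₂ e₁)

  Y-shift : ∀ {a b} → Y a ≡ Y b → ∀ t → Y (a + t) ≡ Y (b + t)
  Y-shift {a} {b} Ya≡Yb zero    =
    trans (cong Y (+-identityʳ a)) (trans Ya≡Yb (cong Y (sym (+-identityʳ b))))
  Y-shift {a} {b} Ya≡Yb (suc t) = begin
    Y (a + suc t)   ≡⟨ cong Y (+-suc a t) ⟩
    Y (suc (a + t)) ≡⟨ step-injective (digit (a + t)) (digit (b + t)) (Y-step (a + t))
                         (trans (Y-step (b + t))
                                (cong (_+ d * bit (digit (b + t))) (sym (Y-shift Ya≡Yb t)))) ⟩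
    Y (suc (b + t)) ≡⟨ cong Y (+-suc b t) ⟨
    Y (b + suc t)   ∎
    where open ≡-Reasoning

  Y-repeat⇒return : ∀ {a b} → a ≤ b → a ≤ suc q′ → Y a ≡ Y b → Y (b ∸ a) ≡ Y 0
  Y-repeat⇒return {a} {b} a≤b a≤q Ya≡Yb = begin
    Y (b ∸ a)                ≡⟨ Y-periodic (b ∸ a) ⟨
    Y (b ∸ a + suc q′)       ≡⟨ cong Y shift ⟩
    Y (b + (suc q′ ∸ a))     ≡⟨ Y-shift Ya≡Yb (suc q′ ∸ a) ⟨
    Y (a + (suc q′ ∸ a))     ≡⟨ cong Y (m+[n∸m]≡n a≤q) ⟩
    Y (suc q′)               ≡⟨ Y-periodic 0 ⟩
    Y 0                      ∎
    where
    open ≡-Reasoning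
    shift : b ∸ a + suc q′ ≡ b + (suc q′ ∸ a)
    shift = begin
      b ∸ a + suc q′       ≡⟨ +-comm (b ∸ a) (suc q′) ⟩
      suc q′ + (b ∸ a)     ≡⟨ +-∸-assoc (suc q′) a≤b ⟨
      (suc q′ + b) ∸ a     ≡⟨ cong (_∸ a) (+-comm (suc q′) b) ⟩
      (b + suc q′) ∸ a     ≡⟨ +-∸-assoc b a≤q ⟩
      b + (suc q′ ∸ a)     ∎

  first-return : ∃[ s ] Y (suc s) ≡ Y 0 × (∀ {k} → k < s → Y (suc k) ≢ Y 0)
  first-return = minimal (λ s → Y (suc s) ≟ Y 0) (Y-periodic 0)

  s : ℕ
  s = proj₁ first-return

  s≤q′ : s ≤ q′
  s≤q′ = ≮⇒≥ (λ q′<s → proj₂ (proj₂ first-return) q′<s (Y-periodic 0))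

  no-early-repeat : ∀ {a b} → a < b → b ≤ s → Y a ≢ Y b
  no-early-repeat {a} {b} a<b b≤s Ya≡Yb = proj₂ (proj₂ first-return) k<s
    (subst (λ i → Y i ≡ Y 0) (+-∸-assoc 1 a<b)
      (Y-repeat⇒return (<⇒≤ a<b) a≤q Ya≡Yb))
    where
    a≤q : a ≤ suc q′
    a≤q = ≤-trans (<⇒≤ a<b) (≤-trans b≤s (m≤n⇒m≤1+n s≤q′))
    k<s : b ∸ suc a < s
    k<s = ≤-trans (≤-reflexive (sym (+-∸-assoc 1 a<b))) (≤-trans (m∸n≤m b a) b≤s)

  Y-injective : ∀ {a b} → a ≤ s → b ≤ s → Y a ≡ Y b → a ≡ b
  Y-injective {a} {b} a≤s b≤s Ya≡Yb with <-cmp a b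
  ... | tri< a<b _ _ = ⊥-elim (no-early-repeat a<b b≤s Ya≡Yb)
  ... | tri≈ _ a≡b _ = a≡b
  ... | tri> _ _ b<a = ⊥-elim (no-early-repeat b<a a≤s (sym Ya≡Yb))

  ℤ-step : ∀ i → + g ℤ.* + Y (suc i) ≡ + Y i ℤ.+ + (d * bit (digit i))
  ℤ-step i = trans (sym (ℤ.pos-* g (Y (suc i)))) (trans (cong +_ (Y-step i)) (ℤ.pos-+ (Y i) _))

  cycle : ExtremeCycle g d
  cycle = record
    { n     = s
    ; x     = λ j → + Y (toℕ j)
    ; l     = λ j → + (d * bit (digit (toℕ j)))
    ; x-inj = λ {i} {j} eq → toℕ-injective
                (Y-injective (s≤s⁻¹ (toℕ<n i)) (s≤s⁻¹ (toℕ<n j)) (ℤ.+-injective eq))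
    ; l-dig = λ j → digit-cases (digit (toℕ j))
    ; step  = λ j → subst (λ i → + g ℤ.* + Y (suc (toℕ j)) ≡ + Y i ℤ.+ + (d * bit (digit i)))
                          (sym (toℕ-inject₁ j)) (ℤ-step (toℕ j))
    ; close = subst (λ i → + g ℤ.* + Y 0 ≡ + Y i ℤ.+ + (d * bit (digit i))) (sym (toℕ-fromℕ s))
                    (subst (λ y → + g ℤ.* + y ≡ + Y s ℤ.+ + (d * bit (digit s)))
                           (proj₁ (proj₂ first-return)) (ℤ-step s))
    }
    where
    digit-cases : ∀ b → + (d * bit b) ≡ + 0 ⊎ + (d * bit b) ≡ + d
    digit-cases false = inj₁ (cong +_ (*-zeroʳ d))
    digit-cases true  = inj₂ (cong +_ (*-identityʳ d))

  cycle-nontrivial : ¬ Trivial cycle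
  cycle-nontrivial (_ , Y₀≡0) = Y₀≢0 (ℤ.+-injective Y₀≡0)

prime⇒2≤ : ∀ {p} → Prime p → 2 ≤ p
prime⇒2≤ {p} p-prime = nonTrivial⇒n>1 p {{prime⇒nonTrivial p-prime}}

-- V ≡ t modulo p, where t ≤ r ≤ k ≤ p counts the digits m of the cycle; so p ∣ m · t,
-- and if p ∣ t then either t ≡ 0 (forcing Y 0 ≡ 0) or every digit is m and p · Y 0 ≡ m.
small-order⇒p∣m : ∀ {p m k} → Prime p → 2 ∣ suc p → Odd m →
                  (C : ExtremeCycle (suc p) m) → ¬ Trivial C →
                  1 ≤ k → m ∣ suc p ^ k ∸ 1 → k ≤ p → p ∣ m
small-order⇒p∣m {p} {m} {k} p-prime 2∣g odd C nontrivial 1≤k m∣g^k∸1 k≤p =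
  [ id , p∣t⇒p∣m ]′ (euclidsLemma m t p-prime p∣m*t)
  where
  instance
    _ = Odd⇒NonZero odd
    _ = prime⇒nonZero p-prime
  open CycleOrbit (prime⇒2≤ p-prime) C
  R V t : ℕ
  R = repunit g r
  V = numeral g (bit ∘ digit) 0 r
  t = numeral 1 (bit ∘ digit) 0 r
  identity : p * R * Y 0 ≡ m * V
  identity = Y-return-identity r (Y-periodic 0)
  p∣m*t : p ∣ m * t
  p∣m*t with numeral-mod p (bit ∘ digit) 0 r
  ... | W , V≡t+pW = ∣m+n∣m⇒∣n (divides (R * Y 0) (begin
      p * (m * W) + m * t ≡⟨ spread m t p W ⟩
      m * (t + p * W)     ≡⟨ cong (m *_) V≡t+pW ⟨
      m * V               ≡⟨ identity ⟨
      p * R * Y 0         ≡⟨ rotate p R (Y 0) ⟩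
      R * Y 0 * p         ∎))
    (∣m⇒∣m*n (m * W) ∣-refl)
    where
    open ≡-Reasoning
    spread : ∀ m t p W → p * (m * W) + m * t ≡ m * (t + p * W)
    spread = solve-∀
    rotate : ∀ p R y → p * R * y ≡ R * y * p
    rotate = solve-∀
  pRY₀≢0 : p * R * Y 0 ≢ 0
  pRY₀≢0 eq = Y₀≢0 2∣g odd nontrivial
    (m*n≡0⇒m≡0 (Y 0) (p * R) {{m*n≢0 p R}} (trans (*-comm (Y 0) (p * R)) eq))
  r≤k : r ≤ k
  r≤k = ∣⇒≤ {{>-nonZero 1≤k}} (Y-return k (Y-order k m∣g^k∸1))
  p∣t⇒p∣m : p ∣ t → p ∣ m
  p∣t⇒p∣m p∣t with t ≟ 0
  ... | yes t≡0 = ⊥-elim (pRY₀≢0 (trans identity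
      (trans (cong (m *_) (numeral₁≡0⇒≡0 g (bit ∘ digit) 0 r t≡0)) (*-zeroʳ m))))
  ... | no  t≢0 = divides (Y 0) (*-cancelʳ-≡ m (Y 0 * p) R (begin
      m * R         ≡⟨ cong (m *_) all-digits-m ⟨
      m * V         ≡⟨ identity ⟨
      p * R * Y 0   ≡⟨ rearrange p R (Y 0) ⟩
      Y 0 * p * R   ∎))
    where
    open ≡-Reasoning
    t≡r : t ≡ r
    t≡r = ≤-antisym (numeral₁-bits≤ digit 0 r)
                    (≤-trans (≤-trans r≤k k≤p) (∣⇒≤ {{≢-nonZero t≢0}} p∣t))
    all-digits-m : V ≡ R
    all-digits-m = numeral₁-bits≡len g digit 0 r t≡r
    rearrange : ∀ p R y → p * R * y ≡ y * p * R
    rearrange = solve-∀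

unit-cycle : ∀ p → ExtremeCycle (suc p) p
unit-cycle p = record
  { n = 0 ; x = λ _ → + 1 ; l = λ _ → + p
  ; x-inj = λ { {zero} {zero} _ → refl }
  ; l-dig = λ _ → inj₂ refl
  ; step  = λ ()
  ; close = cong +_ (cong suc (*-identityʳ p))
  }

unit-cycle-nontrivial : ∀ p → ¬ Trivial (unit-cycle p)
unit-cycle-nontrivial p (_ , ())

primitive∧order<g⇒≡p : ∀ {p m k} → Prime p → 2 ∣ suc p →
                       Primitive (suc p) m → IsOrder (suc p) m k → k < suc p → m ≡ p
primitive∧order<g⇒≡p {p} {m} p-prime 2∣g
  ((odd , C , nontrivial) , proper-complete) (1≤k , m∣g^k∸1 , _) k<g with m ≟ p
... | yes m≡p = m≡p
... | no  m≢p = ⊥-elim (unit-cycle-nontrivial p (proj₂ p-complete (unit-cycle p)))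
  where
  p-complete : Complete (suc p) p
  p-complete = proper-complete p
    (small-order⇒p∣m p-prime 2∣g odd C nontrivial 1≤k m∣g^k∸1 (s≤s⁻¹ k<g)) (m≢p ∘ sym)

+1≡^suc⇒coprime : ∀ {a g k} → a + 1 ≡ g ^ suc k → Coprime a g
+1≡^suc⇒coprime {a} {g} {k} eq {i} (i∣a , i∣g) =
  ∣1⇒≡1 (∣m+n∣m⇒∣n (subst (i ∣_) (sym eq) (∣m⇒∣m*n (g ^ k) i∣g)) i∣a)

fixed-point⇒p∣d : ∀ {p d y} .{{_ : NonZero p}} b → suc p * y ≡ y + d * bit b → y ≢ 0 → p ∣ d
fixed-point⇒p∣d {p} {d} {y} false eq y≢0 = ⊥-elim (y≢0 (*-cancelˡ-≡ y 0 p
  (+-cancelˡ-≡ y _ _ (trans eq (cong (λ z → y + z) (trans (*-zeroʳ d) (sym (*-zeroʳ p))))))))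
fixed-point⇒p∣d {p} {d} {y} true  eq _   = divides y (begin
  d           ≡⟨ *-identityʳ d ⟨
  d * 1       ≡⟨ +-cancelˡ-≡ y _ _ eq ⟨
  p * y       ≡⟨ *-comm p y ⟩
  y * p       ∎)
  where open ≡-Reasoning

module LargePrimeOrder {p q′ : ℕ} (p-prime : Prime p) (2∣g : 2 ∣ suc p)
                       (q-prime : Prime (suc q′)) (g<q : suc p < suc q′) where
  instance _ = prime⇒nonZero p-prime

  g q M : ℕ
  g = suc p
  q = suc q′
  M = repunit g q

  instance _ = m*n≢0 p M

  pM+1≡g^q : p * M + 1 ≡ g ^ q
  pM+1≡g^q = repunit-power p q

  d∣M⇒d∣g^q∸1 : ∀ {d} → d ∣ M → d ∣ g ^ q ∸ 1
  d∣M⇒d∣g^q∸1 {d} d∣M =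
    subst (d ∣_) (trans (sym (m+n∸n≡m (p * M) 1)) (cong (_∸ 1) pM+1≡g^q)) (∣n⇒∣m*n p d∣M)

  M-odd : Odd M
  M-odd 2∣M with ∣1⇒≡1 (∣m+n∣m⇒∣n (subst (2 ∣_) (+-comm 1 _) 2∣M)
                                   (∣m⇒∣m*n (repunit g q′) 2∣g))
  ... | ()

  d∣M⇒odd : ∀ {d} → d ∣ M → Odd d
  d∣M⇒odd d∣M 2∣d = M-odd (∣-trans 2∣d d∣M)

  p∤M : ¬ p ∣ M
  p∤M p∣M with repunit-mod p q
  ... | W , M≡q+pW with prime⇒irreducible q-prime
    (∣m+n∣m⇒∣n (subst (p ∣_) (trans M≡q+pW (+-comm q (p * W))) p∣M) (∣m⇒∣m*n W (∣-refl {p})))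
  ...   | inj₁ p≡1 = <-irrefl (sym p≡1) (prime⇒2≤ p-prime)
  ...   | inj₂ p≡q = <-irrefl p≡q (<-trans (n<1+n p) g<q)

  Word : Set
  Word = Vec Bool q

  word-digit : Word → ℕ → Bool
  word-digit w i = lookup w (i mod q)

  value : Word → ℕ
  value w = numeral g (bit ∘ word-digit w) 0 q

  -- d is admissible when some non-zero q-periodic 0/1 digit sequence has value
  -- divisible by (g ^ q ∸ 1) / d, i.e. by p · M / d.
  Admissible : ℕ → Set
  Admissible d = Σ Word λ w → value w ≢ 0 × p * M ∣ d * value w

  admissible? : Decidable Admissible
  admissible? d = any-Vec-Bool? (λ w → ¬? (value w ≟ 0) ×-dec p * M ∣? d * value w)

  -- The cycle is X j ≡ d · N j / (p · M) for the rotations N j of w; divisibility passes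
  -- from N j to N (j + 1) because p · M ≡ g ^ q ∸ 1 is coprime to g.
  admissible⇒incomplete : ∀ {d} → Odd d → Admissible d →
                          Σ (ExtremeCycle g d) (λ C → ¬ Trivial C)
  admissible⇒incomplete {d} odd (w , value≢0 , pM∣dN₀) = cycle , cycle-nontrivial
    where
    instance _ = Odd⇒NonZero odd
    c : ℕ → ℕ
    c = bit ∘ word-digit w
    N : ℕ → ℕ
    N j = numeral g c j q
    N-step : ∀ j → g * N (suc j) ≡ N j + c j * (p * M)
    N-step j = +-cancelˡ-≡ (c j) _ _ (begin
      c j + g * N (suc j)         ≡⟨ numeral-snoc g c j q ⟩
      N j + g ^ q * c (j + q)     ≡⟨ cong₂ (λ G b → N j + G * bit (lookup w b))
                                           (sym pM+1≡g^q) (mod-periodic j q′) ⟩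
      N j + (p * M + 1) * c j     ≡⟨ regroup (N j) (p * M) (c j) ⟩
      c j + (N j + c j * (p * M)) ∎)
      where
      open ≡-Reasoning
      regroup : ∀ N P c → N + (P + 1) * c ≡ c + (N + c * P)
      regroup = solve-∀
    pM∣dN : ∀ j → p * M ∣ d * N j
    pM∣dN zero    = pM∣dN₀
    pM∣dN (suc j) = coprime-divisor (+1≡^suc⇒coprime {g = g} {k = q′} pM+1≡g^q)
      (subst (p * M ∣_) shift (∣m∣n⇒∣m+n (pM∣dN j) (∣m⇒∣m*n (d * c j) ∣-refl)))
      where
      open ≡-Reasoning
      shift : d * N j + p * M * (d * c j) ≡ g * (d * N (suc j))
      shift = begin
        d * N j + p * M * (d * c j) ≡⟨ factor d (N j) (c j) (p * M) ⟩
        d * (N j + c j * (p * M))   ≡⟨ cong (d *_) (N-step j) ⟨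
        d * (g * N (suc j))         ≡⟨ swap d g (N (suc j)) ⟩
        g * (d * N (suc j))         ∎
        where
        factor : ∀ d N c P → d * N + P * (d * c) ≡ d * (N + c * P)
        factor = solve-∀
        swap : ∀ d g N → d * (g * N) ≡ g * (d * N)
        swap = solve-∀
    X : ℕ → ℕ
    X j = quotient (pM∣dN j)
    dN≡X*pM : ∀ j → d * N j ≡ X j * (p * M)
    dN≡X*pM j = _∣_.equality (pM∣dN j)
    X-step : ∀ j → g * X (suc j) ≡ X j + d * c j
    X-step j = *-cancelʳ-≡ _ _ (p * M) (begin
      g * X (suc j) * (p * M)   ≡⟨ *-assoc g (X (suc j)) (p * M) ⟩
      g * (X (suc j) * (p * M)) ≡⟨ cong (g *_) (dN≡X*pM (suc j)) ⟨
      g * (d * N (suc j))       ≡⟨ swap g d (N (suc j)) ⟩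
      d * (g * N (suc j))       ≡⟨ cong (d *_) (N-step j) ⟩
      d * (N j + c j * (p * M)) ≡⟨ expand d (N j) (c j) (p * M) ⟩
      d * N j + d * c j * (p * M) ≡⟨ cong (_+ d * c j * (p * M)) (dN≡X*pM j) ⟩
      X j * (p * M) + d * c j * (p * M) ≡⟨ *-distribʳ-+ (p * M) (X j) (d * c j) ⟨
      (X j + d * c j) * (p * M) ∎)
      where
      open ≡-Reasoning
      swap : ∀ g d N → g * (d * N) ≡ d * (g * N)
      swap = solve-∀
      expand : ∀ d N c P → d * (N + c * P) ≡ d * N + d * c * P
      expand = solve-∀
    X-periodic : ∀ j → X (j + q) ≡ X j
    X-periodic j = *-cancelʳ-≡ _ _ (p * M) (begin
      X (j + q) * (p * M) ≡⟨ dN≡X*pM (j + q) ⟨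
      d * N (j + q)       ≡⟨ cong (d *_) (numeral-periodic g q c-periodic j q) ⟩
      d * N j             ≡⟨ dN≡X*pM j ⟩
      X j * (p * M)       ∎)
      where
      open ≡-Reasoning
      c-periodic : ∀ i → c (i + q) ≡ c i
      c-periodic i = cong (bit ∘ lookup w) (mod-periodic i q′)
    X₀≢0 : X 0 ≢ 0
    X₀≢0 X₀≡0 = value≢0 (m*n≡0⇒m≡0 (N 0) d
      (trans (*-comm (N 0) d) (trans (dN≡X*pM 0) (cong (_* (p * M)) X₀≡0))))
    open OrbitCycle 2∣g odd q′ X (word-digit w) X-step X-periodic X₀≢0

  lookup-tabulate-mod : ∀ (f : ℕ → Bool) i → i < q → lookup (tabulate (f ∘ toℕ)) (i mod q) ≡ f i
  lookup-tabulate-mod f i i<q = trans (lookup∘tabulate (f ∘ toℕ) (i mod q))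
                                      (cong f (trans (toℕ-mod i q′) (m<n⇒m%n≡m i<q)))

  incomplete⇒admissible : ∀ {d} → d ∣ M → (C : ExtremeCycle g d) → ¬ Trivial C → Admissible d
  incomplete⇒admissible {d} d∣M C nontrivial = w , value≢0 , divides (Y 0) dN≡Y₀pM
    where
    instance _ = Odd⇒NonZero (d∣M⇒odd d∣M)
    open CycleOrbit (prime⇒2≤ p-prime) C hiding (g)
    w : Word
    w = tabulate (digit ∘ toℕ)
    value≡ : value w ≡ numeral g (bit ∘ digit) 0 q
    value≡ = numeral-cong g 0 q (λ i i<q → cong bit (lookup-tabulate-mod digit i i<q))
    pMY₀≡dN : p * M * Y 0 ≡ d * value w
    pMY₀≡dN = trans (Y-return-identity q (Y-order q (d∣M⇒d∣g^q∸1 d∣M))) (cong (d *_) (sym value≡))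
    dN≡Y₀pM : d * value w ≡ Y 0 * (p * M)
    dN≡Y₀pM = trans (sym pMY₀≡dN) (*-comm (p * M) (Y 0))
    value≢0 : value w ≢ 0
    value≢0 N≡0 = Y₀≢0 2∣g (d∣M⇒odd d∣M) nontrivial
      (m*n≡0⇒m≡0 (Y 0) (p * M) (trans (sym dN≡Y₀pM) (trans (cong (d *_) N≡0) (*-zeroʳ d))))

  -- The cycle length r divides q; r ≡ 1 would make Y 0 a fixed point, forcing p ∣ d ∣ M.
  incomplete⇒order-q : ∀ {d} → d ∣ M → (C : ExtremeCycle g d) → ¬ Trivial C → IsOrder g d q
  incomplete⇒order-q {d} d∣M C nontrivial = s≤s z≤n , d∣M⇒d∣g^q∸1 d∣M , no-smaller-order
    where
    instance _ = Odd⇒NonZero (d∣M⇒odd d∣M)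
    open CycleOrbit (prime⇒2≤ p-prime) C hiding (g)
    no-smaller-order : ∀ j → 1 ≤ j → j < q → ¬ d ∣ g ^ j ∸ 1
    no-smaller-order j 1≤j j<q d∣g^j∸1 =
      [ r≢1 , (λ r≡q → <⇒≱ j<q (subst (_≤ j) r≡q r≤j)) ]′ (prime⇒irreducible q-prime r∣q)
      where
      r∣q : r ∣ q
      r∣q = Y-return q (Y-order q (d∣M⇒d∣g^q∸1 d∣M))
      r≤j : r ≤ j
      r≤j = ∣⇒≤ {{>-nonZero 1≤j}} (Y-return j (Y-order j d∣g^j∸1))
      r≢1 : r ≢ 1
      r≢1 r≡1 = p∤M (∣-trans (fixed-point⇒p∣d (digit 0) fixed Y₀≢0′) d∣M)
        where
        Y₀≢0′ : Y 0 ≢ 0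
        Y₀≢0′ = Y₀≢0 2∣g (d∣M⇒odd d∣M) nontrivial
        fixed : g * Y 0 ≡ Y 0 + d * bit (digit 0)
        fixed = subst (λ y → g * y ≡ Y 0 + d * bit (digit 0))
                      (trans (cong Y (sym r≡1)) (Y-periodic 0)) (Y-step 0)

  -- p digits 1, then 0s: its value is repunit g p ≡ p ≡ 0 modulo p.
  prefix : Word
  prefix = tabulate (λ j → does (toℕ j <? p))

  M-admissible : Admissible M
  M-admissible with repunit-mod p p
  ... | W , R≡p+pW = prefix , value≢0 , subst (p * M ∣_) (*-comm (value prefix) M) (*-monoˡ-∣ M p∣value)
    where
    p≤q : p ≤ q
    p≤q = <⇒≤ (<-trans (n<1+n p) g<q)
    value≡p+pW : value prefix ≡ p + p * W
    value≡p+pW = begin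
      value prefix              ≡⟨ numeral-cong g 0 q (λ i → cong bit ∘ lookup-tabulate-mod below-p i) ⟩
      numeral g c 0 q           ≡⟨ cong (numeral g c 0) (m+[n∸m]≡n p≤q) ⟨
      numeral g c 0 (p + (q ∸ p)) ≡⟨ numeral-prefix g p 0 p (q ∸ p) refl ⟩
      repunit g p               ≡⟨ R≡p+pW ⟩
      p + p * W                 ∎
      where
      open ≡-Reasoning
      below-p : ℕ → Bool
      below-p i = does (i <? p)
      c : ℕ → ℕ
      c = bit ∘ below-p
    value≢0 : value prefix ≢ 0
    value≢0 N≡0 = ≢-nonZero⁻¹ p (m+n≡0⇒m≡0 p (trans (sym value≡p+pW) N≡0))
    p∣value : p ∣ value prefix
    p∣value = subst (p ∣_) (sym value≡p+pW) (∣m∣n⇒∣m+n ∣-refl (∣m⇒∣m*n W ∣-refl))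

  trivial? : ∀ {d} (C : ExtremeCycle g d) → Dec (Trivial C)
  trivial? C = (ExtremeCycle.n C ≟ 0) ×-dec (ExtremeCycle.x C zero ℤ.≟ + 0)

  -- The least admissible divisor of M: its proper divisors are inadmissible, hence complete.
  primitive-of-order-q : ∃[ m ] Primitive g m × IsOrder g m q
  primitive-of-order-q =
    d , ((odd , incomplete) , proper-complete) , incomplete⇒order-q d∣M (proj₁ incomplete) (proj₂ incomplete)
    where
    least : ∃[ d ] (d ∣ M × Admissible d) × (∀ {e} → e < d → ¬ (e ∣ M × Admissible e))
    least = minimal (λ d → d ∣? M ×-dec admissible? d) (∣-refl , M-admissible)
    d : ℕ
    d = proj₁ least
    d∣M : d ∣ M
    d∣M = proj₁ (proj₁ (proj₂ least))
    odd : Odd d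
    odd = d∣M⇒odd d∣M
    instance _ = Odd⇒NonZero odd
    incomplete : Σ (ExtremeCycle g d) (λ C → ¬ Trivial C)
    incomplete = admissible⇒incomplete odd (proj₂ (proj₁ (proj₂ least)))
    proper-complete : ∀ e → e ∣ d → ¬ e ≡ d → Complete g e
    proper-complete e e∣d e≢d = d∣M⇒odd e∣M , λ C → decidable-stable (trivial? C) λ nontrivial →
      proj₂ (proj₂ least) (≤∧≢⇒< (∣⇒≤ e∣d) e≢d) (e∣M , incomplete⇒admissible e∣M C nontrivial)
      where
      e∣M : e ∣ M
      e∣M = ∣-trans e∣d d∣M

corollary2p24 : (p : ℕ) → Prime p → 2 ∣ suc p → 4 ≤ suc p →
    (∀ (m k : ℕ) → Primitive (suc p) m → IsOrder (suc p) m k → k < suc p → m ≡ suc p ∸ 1)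
    × (∀ (q : ℕ) → Prime q → suc p < q → Σ ℕ (λ m → Primitive (suc p) m × IsOrder (suc p) m q))
corollary2p24 p p-prime 2∣g _ =
  (λ m k → primitive∧order<g⇒≡p p-prime 2∣g) ,
  λ { zero     _       ()
    ; (suc q′) q-prime g<q → LargePrimeOrder.primitive-of-order-q p-prime 2∣g q-prime g<q }
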